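{- Let $A(x_1,\dots,x_n)$ be a propositional formula in the propositional variables $x_1,\dots,x_n$, and let $P$ be a Turing program such that for every $n$-tuple $(\phi_1,\dots,\phi_n)$ of closed $\mathcal{L}_{PA}$-formulas, $P([\phi_1],\dots,[\phi_n])$ halts, with output $1$ if $\mathbb{N}\models A(\phi_1,\dots,\phi_n)$ and with output $0$ otherwise. Then $A$ is either a tautology or contradictory (unsatisfiable).
   Context: $\mathcal{L}_{PA}$ is the language of first-order arithmetic; closed formulas have no free variables. $[\phi]$ denotes the Gödel number of the formula $\phi$ under a standard Gödel numbering. $A(\phi_1,\dots,\phi_n)$ denotes the sentence obtained by substituting $\phi_i$ for $x_i$ in $A$, and $\mathbb{N}$ is the standard model of arithmetic. -}

module Defs where

open import Data.Nat using (ℕ; zero; suc; _+_; _*_; _<_)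
open import Data.Fin using (Fin; toℕ)
open import Data.Vec using (Vec; []; _∷_; lookup; map)
open import Data.Bool using (Bool; true; false; not; _∧_; _∨_; if_then_else_)
open import Data.Product using (_×_; Σ; ∃-syntax)
open import Data.Sum using (_⊎_)
open import Data.Empty using (⊥)
open import Relation.Nullary using (¬_)
open import Relation.Binary.PropositionalEquality using (_≡_)

data PForm (n : ℕ) : Set where
  pvar : Fin n → PForm n
  p¬   : PForm n → PForm n
  _p∧_ _p∨_ _p⇒_ _p⇔_ : PForm n → PForm n → PForm n

_⇒ᵇ_ : Bool → Bool → Bool
a ⇒ᵇ b = not a ∨ b

_⇔ᵇ_ : Bool → Bool → Bool
a ⇔ᵇ b = (a ⇒ᵇ b) ∧ (b ⇒ᵇ a)

peval : {n : ℕ} → (Fin n → Bool) → PForm n → Bool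
peval v (pvar i)  = v i
peval v (p¬ A)    = not (peval v A)
peval v (A p∧ B)  = peval v A ∧ peval v B
peval v (A p∨ B)  = peval v A ∨ peval v B
peval v (A p⇒ B)  = peval v A ⇒ᵇ peval v B
peval v (A p⇔ B)  = peval v A ⇔ᵇ peval v B

Tautology : {n : ℕ} → PForm n → Set
Tautology A = ∀ v → peval v A ≡ true

Contradictory : {n : ℕ} → PForm n → Set
Contradictory A = ∀ v → peval v A ≡ false

-- The language L_PA (0, S, +, ×, =), de Bruijn style:
-- Term k / Formula k have at most k free variables; closed = index 0.

data Term (k : ℕ) : Set where
  var  : Fin k → Term k
  `0   : Term k
  `S   : Term k → Term k
  _`+_ _`*_ : Term k → Term k → Term k

data Formula (k : ℕ) : Set where
  _`=_ : Term k → Term k → Formula k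
  `¬   : Formula k → Formula k
  _`∧_ _`∨_ _`⇒_ _`⇔_ : Formula k → Formula k → Formula k
  `∀ `∃ : Formula (suc k) → Formula k

Sentence : Set
Sentence = Formula 0

⟦_⟧t : {k : ℕ} → Term k → Vec ℕ k → ℕ
⟦ var i ⟧t ρ   = lookup ρ i
⟦ `0 ⟧t ρ      = 0
⟦ `S t ⟧t ρ    = suc (⟦ t ⟧t ρ)
⟦ s `+ t ⟧t ρ  = ⟦ s ⟧t ρ + ⟦ t ⟧t ρ
⟦ s `* t ⟧t ρ  = ⟦ s ⟧t ρ * ⟦ t ⟧t ρ

Sat : {k : ℕ} → Formula k → Vec ℕ k → Set
Sat (s `= t) ρ  = ⟦ s ⟧t ρ ≡ ⟦ t ⟧t ρ
Sat (`¬ φ) ρ    = ¬ Sat φ ρ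
Sat (φ `∧ ψ) ρ  = Sat φ ρ × Sat ψ ρ
Sat (φ `∨ ψ) ρ  = Sat φ ρ ⊎ Sat ψ ρ
Sat (φ `⇒ ψ) ρ  = Sat φ ρ → Sat ψ ρ
Sat (φ `⇔ ψ) ρ  = (Sat φ ρ → Sat ψ ρ) × (Sat ψ ρ → Sat φ ρ)
Sat (`∀ φ) ρ    = (n : ℕ) → Sat φ (n ∷ ρ)
Sat (`∃ φ) ρ    = Σ ℕ (λ n → Sat φ (n ∷ ρ))

_⊨_ : Set → Sentence → Set
_ ⊨ φ = Sat φ []

subst : {n : ℕ} → PForm n → Vec Sentence n → Sentence
subst (pvar i) φs  = lookup φs i
subst (p¬ A) φs    = `¬ (subst A φs)
subst (A p∧ B) φs  = subst A φs `∧ subst B φs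
subst (A p∨ B) φs  = subst A φs `∨ subst B φs
subst (A p⇒ B) φs  = subst A φs `⇒ subst B φs
subst (A p⇔ B) φs  = subst A φs `⇔ subst B φs

tri : ℕ → ℕ
tri zero    = 0
tri (suc m) = suc m + tri m

pair : ℕ → ℕ → ℕ
pair a b = tri (a + b) + b

gnt : {k : ℕ} → Term k → ℕ
gnt (var i)  = pair 0 (toℕ i)
gnt `0       = pair 1 0
gnt (`S t)   = pair 2 (gnt t)
gnt (s `+ t) = pair 3 (pair (gnt s) (gnt t))
gnt (s `* t) = pair 4 (pair (gnt s) (gnt t))

gn : {k : ℕ} → Formula k → ℕ
gn (s `= t)  = pair 0 (pair (gnt s) (gnt t))
gn (`¬ φ)    = pair 1 (gn φ)
gn (φ `∧ ψ)  = pair 2 (pair (gn φ) (gn ψ))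
gn (φ `∨ ψ)  = pair 3 (pair (gn φ) (gn ψ))
gn (φ `⇒ ψ)  = pair 4 (pair (gn φ) (gn ψ))
gn (φ `⇔ ψ)  = pair 5 (pair (gn φ) (gn ψ))
gn (`∀ φ)    = pair 6 (gn φ)
gn (`∃ φ)    = pair 7 (gn φ)

-- Programs: (codes of) partial recursive functions of arity n,
-- with their big-step halting/output relation  P [ xs ]⇓ y.

data Prog : ℕ → Set where
  zeroF : {n : ℕ} → Prog n
  succF : Prog 1
  proj  : {n : ℕ} → Fin n → Prog n
  comp  : {m n : ℕ} → Prog m → Vec (Prog n) m → Prog n
  prec  : {n : ℕ} → Prog n → Prog (suc (suc n)) → Prog (suc n)
  mu    : {n : ℕ} → Prog (suc n) → Prog n

data _[_]⇓_ : {n : ℕ} → Prog n → Vec ℕ n → ℕ → Set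
data _[_]⇓*_ : {m n : ℕ} → Vec (Prog n) m → Vec ℕ n → Vec ℕ m → Set

data _[_]⇓_ where
  zero⇓ : {n : ℕ} {xs : Vec ℕ n} → zeroF [ xs ]⇓ 0
  succ⇓ : {x : ℕ} → succF [ x ∷ [] ]⇓ suc x
  proj⇓ : {n : ℕ} {i : Fin n} {xs : Vec ℕ n} → proj i [ xs ]⇓ lookup xs i
  comp⇓ : {m n : ℕ} {f : Prog m} {gs : Vec (Prog n) m} {xs : Vec ℕ n}
          {ys : Vec ℕ m} {z : ℕ} →
          gs [ xs ]⇓* ys → f [ ys ]⇓ z → comp f gs [ xs ]⇓ z
  prec0⇓ : {n : ℕ} {f : Prog n} {g : Prog (suc (suc n))} {xs : Vec ℕ n} {z : ℕ} →
           f [ xs ]⇓ z → prec f g [ 0 ∷ xs ]⇓ z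
  precS⇓ : {n : ℕ} {f : Prog n} {g : Prog (suc (suc n))} {xs : Vec ℕ n}
           {k r z : ℕ} →
           prec f g [ k ∷ xs ]⇓ r → g [ k ∷ r ∷ xs ]⇓ z →
           prec f g [ suc k ∷ xs ]⇓ z
  mu⇓   : {n : ℕ} {f : Prog (suc n)} {xs : Vec ℕ n} {y : ℕ} →
          f [ y ∷ xs ]⇓ 0 →
          ((z : ℕ) → z < y → Σ ℕ (λ k → f [ z ∷ xs ]⇓ suc k)) →
          mu f [ xs ]⇓ y

data _[_]⇓*_ where
  []⇓  : {n : ℕ} {xs : Vec ℕ n} → [] [ xs ]⇓* []
  ∷⇓   : {m n : ℕ} {g : Prog n} {gs : Vec (Prog n) m} {xs : Vec ℕ n}
         {y : ℕ} {ys : Vec ℕ m} →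
         g [ xs ]⇓ y → gs [ xs ]⇓* ys → (g ∷ gs) [ xs ]⇓* (y ∷ ys)

DecidesTruthOf : {n : ℕ} → Prog n → PForm n → Set
DecidesTruthOf {n} P A =
  (φs : Vec Sentence n) →
  ∃[ y ] (P [ map gn φs ]⇓ y) ×
         ((ℕ ⊨ subst A φs × y ≡ 1) ⊎ (¬ (ℕ ⊨ subst A φs) × y ≡ 0))

-- If A is neither a tautology nor a contradiction, fix assignments v⁺ and v⁻ with A true
-- under v⁺ and false under v⁻. For a sentence ψ, substitute for xᵢ a sentence that is
-- true, false, ψ or ¬ψ according to (v⁺ i, v⁻ i); then A(φ⃗) is true if ψ is and false if
-- it is not, and the Gödel numbers of the φᵢ are computable from ⌜ψ⌝. Composing with P thus
-- decides arithmetic truth, contradicting Tarski's undefinability theorem. The latter comes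
-- from the diagonal lemma, which needs that every program is represented by a formula of
-- L_PA; primitive recursion is represented through Gödel's β-function.
module Submission where

open import Defs
open import Data.Nat
open import Data.Nat.Properties
open import Data.Nat.Divisibility
open import Data.Nat.DivMod
open import Data.Nat.Coprimality using (Coprime; coprime-divisor; coprime-Bézout; 1-coprimeTo)
open import Data.Nat.GCD using (module Bézout)
open import Data.Nat.Solver using (module +-*-Solver)
open import Data.Product using (Σ; ∃-syntax; ∃₂; _×_; _,_; proj₁; proj₂)
open import Data.Sum using (_⊎_; inj₁; inj₂; [_,_])
open import Data.Bool using (Bool; true; false; not; _∧_; _∨_)
import Data.Bool as Bool
open import Data.Bool.Properties using (¬-not)
open import Data.Vec.Functional using () renaming (_∷_ to _∷ᶠ_)
open import Data.Empty using (⊥-elim)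
open import Data.Fin using (Fin; zero; suc; #_; _↑ˡ_; _↑ʳ_)
open import Data.Vec using (Vec; []; _∷_; lookup; _++_; map; tabulate)
open import Data.Vec.Properties using (lookup-++ˡ; lookup-++ʳ; lookup-map; lookup∘tabulate)
open import Function using (_∘_)
open import Function.Bundles using (_⇔_; mk⇔; Equivalence)
open import Function.Properties.Equivalence using (⇔-setoid; ⇔-isEquivalence)
open import Function.Construct.Identity using (↠-id)
open import Function.Related.TypeIsomorphisms using (→-cong-⇔; ¬-cong-⇔)
open import Data.Product.Function.NonDependent.Propositional using (_×-⇔_)
open import Data.Product.Function.Dependent.Propositional using (Σ-⇔)
open import Data.Sum.Function.Propositional using (_⊎-⇔_)
open import Level using (0ℓ)
open import Relation.Nullary using (¬_; yes; no)
open import Relation.Binary.Definitions using (tri<; tri≈; tri>)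
open import Relation.Binary.Structures using (IsEquivalence)
import Relation.Binary.Reasoning.Setoid as SetoidReasoning
open import Relation.Binary.PropositionalEquality
  using (_≡_; refl; sym; trans; cong; cong₂; module ≡-Reasoning; subst₂)
  renaming (subst to ≡-subst)

open +-*-Solver using (solve; _:=_; _:+_; _:*_; con)
open Equivalence using (to; from)
open IsEquivalence (⇔-isEquivalence {0ℓ}) using ()
  renaming (sym to ⇔-sym; trans to ⇔-trans; reflexive to ⇔-reflexive)
module ⇔-Reasoning = SetoidReasoning (⇔-setoid 0ℓ)

Σ-cong-⇔ : ∀ {A : Set} {P Q : A → Set} → (∀ {x} → P x ⇔ Q x) → Σ A P ⇔ Σ A Q
Σ-cong-⇔ {A} = Σ-⇔ (↠-id A)

Π-cong-⇔ : ∀ {A : Set} {P Q : A → Set} → (∀ x → P x ⇔ Q x) → ((x : A) → P x) ⇔ ((x : A) → Q x)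
Π-cong-⇔ P⇔Q = mk⇔ (λ p x → to (P⇔Q x) (p x)) (λ q x → from (P⇔Q x) (q x))

-- Gödel's β-function

-- r = c mod m, phrased with ∃ and + only so that it is expressible in L_PA.
Remainder : ℕ → ℕ → ℕ → Set
Remainder c m r = (∃[ q ] c ≡ q * m + r) × (∃[ w ] r + suc w ≡ m)

Remainder⇒%≡ : ∀ {c m r} → Remainder c (suc m) r → c % suc m ≡ r
Remainder⇒%≡ {m = m} {r} ((q , refl) , (w , r+1+w≡1+m)) = begin
  (q * suc m + r) % suc m  ≡⟨ cong (_% suc m) (+-comm (q * suc m) r) ⟩
  (r + q * suc m) % suc m  ≡⟨ [m+kn]%n≡m%n r q (suc m) ⟩
  r % suc m                ≡⟨ m<n⇒m%n≡m (≡-subst (r <_) r+1+w≡1+m (m<m+n r z<s)) ⟩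
  r                        ∎
  where open ≡-Reasoning

%-Remainder : ∀ c m .{{_ : NonZero m}} → Remainder c m (c % m)
%-Remainder c m =
  (c / m , trans (m≡m%n+[m/n]*n c m) (+-comm (c % m) _)) ,
  (m ∸ suc (c % m) , trans (+-suc (c % m) _) (m+[n∸m]≡n (m%n<n c m)))

%-cong-+ : ∀ n .{{_ : NonZero n}} {a b c d} →
           a % n ≡ b % n → c % n ≡ d % n → (a + c) % n ≡ (b + d) % n
%-cong-+ n {a} {b} {c} {d} a≡b c≡d = trans (%-distribˡ-+ a c n)
  (trans (cong₂ (λ x y → (x + y) % n) a≡b c≡d) (sym (%-distribˡ-+ b d n)))

%-cong-* : ∀ n .{{_ : NonZero n}} {a b c d} →
           a % n ≡ b % n → c % n ≡ d % n → (a * c) % n ≡ (b * d) % n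
%-cong-* n {a} {b} {c} {d} a≡b c≡d = trans (%-distribˡ-* a c n)
  (trans (cong₂ (λ x y → (x * y) % n) a≡b c≡d) (sym (%-distribˡ-* b d n)))

coprime-* : ∀ {a b m} → Coprime a m → Coprime b m → Coprime (a * b) m
coprime-* {a} {b} {m} a⊥m b⊥m {e} (e∣ab , e∣m) = b⊥m (coprime-divisor e⊥a e∣ab , e∣m)
  where
  e⊥a : Coprime e a
  e⊥a (f∣e , f∣a) = a⊥m (f∣a , ∣-trans f∣e e∣m)

modular-inverse : ∀ {M m} → Coprime M (suc m) → ∃[ u ] (u * M) % suc m ≡ 1 % suc m
modular-inverse {M} {m} M⊥n with coprime-Bézout M⊥n
... | Bézout.+- x y 1+yn≡xM = x , trans (cong (_% suc m) (sym 1+yn≡xM)) ([m+kn]%n≡m%n 1 y (suc m))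
-- Here x M ≡ -1, so m x M ≡ -m ≡ 1 modulo m + 1.
... | Bézout.-+ x y 1+xM≡yn = m * x , (begin
  (m * x * M) % suc m                ≡⟨ sym ([m+n]%n≡m%n (m * x * M) (suc m)) ⟩
  (m * x * M + suc m) % suc m        ≡⟨ cong (_% suc m) (begin
    m * x * M + suc m                  ≡⟨ solve 3 (λ m x M → m :* x :* M :+ (con 1 :+ m)
                                                          := con 1 :+ m :* (con 1 :+ x :* M)) refl m x M ⟩
    1 + m * (1 + x * M)                ≡⟨ cong (λ z → 1 + m * z) 1+xM≡yn ⟩
    1 + m * (y * suc m)                ≡⟨ cong (1 +_) (sym (*-assoc m y (suc m))) ⟩
    1 + (m * y) * suc m                ∎) ⟩
  (1 + (m * y) * suc m) % suc m      ≡⟨ [m+kn]%n≡m%n 1 (m * y) (suc m) ⟩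
  1 % suc m                          ∎)
  where open ≡-Reasoning

adjust-residue : ∀ {M m} → Coprime M (suc m) → ∀ c a → ∃[ t ] (c + t * M) % suc m ≡ a % suc m
-- t = s u, where u is the inverse of M and s ≡ a - c.
adjust-residue {M} {m} M⊥n c a = s * u , (begin
  (c + s * u * M) % n        ≡⟨ cong (λ z → (c + z) % n) (*-assoc s u M) ⟩
  (c + s * (u * M)) % n      ≡⟨ %-cong-+ n {c} {c} refl (%-cong-* n {s} {s} refl uM≡1) ⟩
  (c + s * 1) % n            ≡⟨ cong (λ z → (c + z) % n) (*-identityʳ s) ⟩
  (c + s) % n                ≡⟨ cong (_% n) c+s≡a+kn ⟩
  (a + suc (c / n) * n) % n  ≡⟨ [m+kn]%n≡m%n a (suc (c / n)) n ⟩
  a % n                      ∎)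
  where
  open ≡-Reasoning
  n u s : ℕ
  n = suc m
  u = proj₁ (modular-inverse M⊥n)
  s = (n ∸ c % n) + a
  uM≡1 : (u * M) % n ≡ 1 % n
  uM≡1 = proj₂ (modular-inverse M⊥n)
  c+s≡a+kn : c + s ≡ a + suc (c / n) * n
  c+s≡a+kn = begin
    c + ((n ∸ c % n) + a)                      ≡⟨ cong (_+ ((n ∸ c % n) + a)) (m≡m%n+[m/n]*n c n) ⟩
    (c % n + (c / n) * n) + ((n ∸ c % n) + a)  ≡⟨ solve 5 (λ r q n x a → (r :+ q :* n) :+ (x :+ a)
                                                                   := (r :+ x) :+ q :* n :+ a)
                                                          refl (c % n) (c / n) n (n ∸ c % n) a ⟩
    (c % n + (n ∸ c % n)) + (c / n) * n + a    ≡⟨ cong (λ z → z + (c / n) * n + a) (m+[n∸m]≡n (m%n≤n c n)) ⟩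
    n + (c / n) * n + a                        ≡⟨ +-comm (n + (c / n) * n) a ⟩
    a + suc (c / n) * n                        ∎

∏-suc : (ℕ → ℕ) → ℕ → ℕ
∏-suc m zero    = 1
∏-suc m (suc k) = ∏-suc m k * suc (m k)

suc∣∏-suc : ∀ m {i k} → i < k → suc (m i) ∣ ∏-suc m k
suc∣∏-suc m {i} {suc k} i<1+k with m≤n⇒m<n∨m≡n (≤-pred i<1+k)
... | inj₁ i<k  = ∣-trans (suc∣∏-suc m i<k) (m∣m*n (suc (m k)))
... | inj₂ refl = n∣m*n (∏-suc m k)

coprime-∏-suc : ∀ m {j k} → j ≤ k → (∀ {i} → i < k → Coprime (suc (m i)) (suc (m k))) →
                Coprime (∏-suc m j) (suc (m k))
coprime-∏-suc m {zero}  _     _   = 1-coprimeTo _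
coprime-∏-suc m {suc j} 1+j≤k cop =
  coprime-* (coprime-∏-suc m (≤-trans (n≤1+n j) 1+j≤k) cop) (cop 1+j≤k)

chinese-remainder : ∀ (m a : ℕ → ℕ) k →
  (∀ {i j} → i < j → j < k → Coprime (suc (m i)) (suc (m j))) →
  ∃[ c ] ∀ {i} → i < k → c % suc (m i) ≡ a i % suc (m i)
chinese-remainder m a zero    _   = 0 , λ ()
chinese-remainder m a (suc k) cop = c + t * M , residues
  where
  IH : ∃[ c ] ∀ {i} → i < k → c % suc (m i) ≡ a i % suc (m i)
  IH = chinese-remainder m a k (λ i<j j<k → cop i<j (m<n⇒m<1+n j<k))
  c M : ℕ
  c = proj₁ IH
  M = ∏-suc m k
  adjust : ∃[ t ] (c + t * M) % suc (m k) ≡ a k % suc (m k)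
  adjust = adjust-residue (coprime-∏-suc m ≤-refl (λ i<k → cop i<k ≤-refl)) c (a k)
  t : ℕ
  t = proj₁ adjust
  residues : ∀ {i} → i < suc k → (c + t * M) % suc (m i) ≡ a i % suc (m i)
  residues i<1+k with m≤n⇒m<n∨m≡n (≤-pred i<1+k)
  ... | inj₁ i<k  = trans (%-remove-+ʳ c (∣-trans (suc∣∏-suc m i<k) (n∣m*n t))) (proj₂ IH i<k)
  ... | inj₂ refl = proj₂ adjust

n≤n! : ∀ n → n ≤ n !
n≤n! zero    = z≤n
n≤n! (suc n) = m≤m*n (suc n) (n !) {{n !≢0}}

m≤n⇒m∣n! : ∀ {m n} → 1 ≤ m → m ≤ n → m ∣ n !
m≤n⇒m∣n! {suc m} _ m≤n = ∣-trans (m∣m*n (m !)) (m≤n⇒m!∣n! m≤n)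

-- Gödel's β(c, d, i) is c mod β-modulus d i.
β-modulus : ℕ → ℕ → ℕ
β-modulus d i = suc (suc i * d)

-- A common divisor e of the two moduli divides their difference (1 + o) N!, where
-- j = 1 + i + o, and is coprime to N!; so e ∣ 1 + o ∣ N!, which forces e = 1.
coprime-β-moduli : ∀ {N i j} → i < j → j ≤ N →
                   Coprime (β-modulus (N !) i) (β-modulus (N !) j)
coprime-β-moduli {N} {i} i<j j≤N with m≤n⇒∃[o]m+o≡n i<j
... | o , refl = λ (e∣mᵢ , e∣mⱼ) → e⊥d e∣mᵢ (∣-refl , e∣d e∣mᵢ e∣mⱼ)
  where
  d : ℕ
  d = N !
  mⱼ≡mᵢ+[1+o]d : suc (suc (suc i + o) * d) ≡ suc (suc i * d) + suc o * d
  mⱼ≡mᵢ+[1+o]d = solve 3 (λ i o d → con 1 :+ (con 2 :+ i :+ o) :* d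
                                   := (con 1 :+ (con 1 :+ i) :* d) :+ (con 1 :+ o) :* d) refl i o d
  e⊥d : ∀ {e} → e ∣ suc (suc i * d) → Coprime e d
  e⊥d e∣mᵢ {f} (f∣e , f∣d) = ∣1⇒≡1 (∣m+n∣m⇒∣n (≡-subst (f ∣_) (+-comm 1 (suc i * d)) (∣-trans f∣e e∣mᵢ))
                                           (∣-trans f∣d (n∣m*n (suc i))))
  e∣d : ∀ {e} → e ∣ suc (suc i * d) → e ∣ suc (suc (suc i + o) * d) → e ∣ d
  e∣d {e} e∣mᵢ e∣mⱼ = ∣-trans e∣1+o (m≤n⇒m∣n! (s≤s z≤n) (≤-trans (s≤s (m≤n+m o i)) j≤N))
    where
    e∣1+o : e ∣ suc o
    e∣1+o = coprime-divisor (e⊥d e∣mᵢ)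
      (≡-subst (e ∣_) (*-comm (suc o) d) (∣m+n∣m⇒∣n (≡-subst (e ∣_) mⱼ≡mᵢ+[1+o]d e∣mⱼ) e∣mᵢ))

sumTo : (ℕ → ℕ) → ℕ → ℕ
sumTo a zero    = a 0
sumTo a (suc k) = a (suc k) + sumTo a k

≤-sumTo : ∀ a {i k} → i ≤ k → a i ≤ sumTo a k
≤-sumTo a {zero}  {zero}  _     = ≤-refl
≤-sumTo a {i}     {suc k} i≤1+k with m≤n⇒m<n∨m≡n i≤1+k
... | inj₁ i<1+k = ≤-trans (≤-sumTo a (≤-pred i<1+k)) (m≤n+m (sumTo a k) (a (suc k)))
... | inj₂ refl  = m≤m+n (a (suc k)) (sumTo a k)

β-lemma : ∀ (a : ℕ → ℕ) k → ∃₂ λ c d → ∀ {i} → i ≤ k → Remainder c (β-modulus d i) (a i)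
β-lemma a k = c , N ! , λ i≤k → ≡-subst (Remainder c _) (residue i≤k) (%-Remainder c _)
  where
  N : ℕ
  N = k + sumTo a k
  CRT : ∃[ c ] ∀ {i} → i < suc k → c % β-modulus (N !) i ≡ a i % β-modulus (N !) i
  CRT = chinese-remainder (λ i → suc i * N !) a (suc k)
          (λ i<j j<1+k → coprime-β-moduli i<j (≤-trans (≤-pred j<1+k) (m≤m+n k _)))
  c : ℕ
  c = proj₁ CRT
  a≤N! : ∀ {i} → i ≤ k → a i ≤ N !
  a≤N! i≤k = ≤-trans (≤-sumTo a i≤k) (≤-trans (m≤n+m _ k) (n≤n! N))
  residue : ∀ {i} → i ≤ k → c % β-modulus (N !) i ≡ a i
  residue {i} i≤k = trans (proj₂ CRT (s≤s i≤k)) (m<n⇒m%n≡m (s≤s (≤-trans (a≤N! i≤k) (m≤n*m (N !) (suc i)))))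


ext : ∀ {k k′} → (Fin k → Fin k′) → Fin (suc k) → Fin (suc k′)
ext ρ zero    = zero
ext ρ (suc i) = suc (ρ i)

renameᵗ : ∀ {k k′} → (Fin k → Fin k′) → Term k → Term k′
renameᵗ ρ (var i)  = var (ρ i)
renameᵗ ρ `0       = `0
renameᵗ ρ (`S t)   = `S (renameᵗ ρ t)
renameᵗ ρ (s `+ t) = renameᵗ ρ s `+ renameᵗ ρ t
renameᵗ ρ (s `* t) = renameᵗ ρ s `* renameᵗ ρ t

rename : ∀ {k k′} → (Fin k → Fin k′) → Formula k → Formula k′
rename ρ (s `= t) = renameᵗ ρ s `= renameᵗ ρ t
rename ρ (`¬ φ)   = `¬ (rename ρ φ)
rename ρ (φ `∧ ψ) = rename ρ φ `∧ rename ρ ψ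
rename ρ (φ `∨ ψ) = rename ρ φ `∨ rename ρ ψ
rename ρ (φ `⇒ ψ) = rename ρ φ `⇒ rename ρ ψ
rename ρ (φ `⇔ ψ) = rename ρ φ `⇔ rename ρ ψ
rename ρ (`∀ φ)   = `∀ (rename (ext ρ) φ)
rename ρ (`∃ φ)   = `∃ (rename (ext ρ) φ)

Agree : ∀ {k k′} → (Fin k → Fin k′) → Vec ℕ k → Vec ℕ k′ → Set
Agree ρ e e′ = ∀ i → lookup e′ (ρ i) ≡ lookup e i

Agree-ext : ∀ {k k′} {ρ : Fin k → Fin k′} {e e′} x → Agree ρ e e′ → Agree (ext ρ) (x ∷ e) (x ∷ e′)
Agree-ext x agree zero    = refl
Agree-ext x agree (suc i) = agree i

renameᵗ-sem : ∀ {k k′} {ρ : Fin k → Fin k′} {e e′} → Agree ρ e e′ → ∀ t → ⟦ renameᵗ ρ t ⟧t e′ ≡ ⟦ t ⟧t e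
renameᵗ-sem agree (var i)  = agree i
renameᵗ-sem agree `0       = refl
renameᵗ-sem agree (`S t)   = cong suc (renameᵗ-sem agree t)
renameᵗ-sem agree (s `+ t) = cong₂ _+_ (renameᵗ-sem agree s) (renameᵗ-sem agree t)
renameᵗ-sem agree (s `* t) = cong₂ _*_ (renameᵗ-sem agree s) (renameᵗ-sem agree t)

rename-sem : ∀ {k k′} {ρ : Fin k → Fin k′} {e e′} → Agree ρ e e′ → ∀ φ → Sat (rename ρ φ) e′ ⇔ Sat φ e
rename-sem agree (s `= t) = ⇔-reflexive (cong₂ _≡_ (renameᵗ-sem agree s) (renameᵗ-sem agree t))
rename-sem agree (`¬ φ)   = ¬-cong-⇔ (rename-sem agree φ)
rename-sem agree (φ `∧ ψ) = rename-sem agree φ ×-⇔ rename-sem agree ψ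
rename-sem agree (φ `∨ ψ) = rename-sem agree φ ⊎-⇔ rename-sem agree ψ
rename-sem agree (φ `⇒ ψ) = →-cong-⇔ (rename-sem agree φ) (rename-sem agree ψ)
rename-sem agree (φ `⇔ ψ) = →-cong-⇔ (rename-sem agree φ) (rename-sem agree ψ)
                         ×-⇔ →-cong-⇔ (rename-sem agree ψ) (rename-sem agree φ)
rename-sem agree (`∀ φ)   = Π-cong-⇔ λ x → rename-sem (Agree-ext x agree) φ
rename-sem agree (`∃ φ)   = Σ-cong-⇔ λ {x} → rename-sem (Agree-ext x agree) φ

weakenᵗ-sem : ∀ {k} x (e : Vec ℕ k) t → ⟦ renameᵗ suc t ⟧t (x ∷ e) ≡ ⟦ t ⟧t e
weakenᵗ-sem x e = renameᵗ-sem {ρ = suc} {e′ = x ∷ e} λ _ → refl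

-- φ(t), written as ∃x (x = t ∧ φ(x)) so that no substitution is needed.
_[0≔_] : ∀ {k} → Formula (suc k) → Term k → Formula k
φ [0≔ t ] = `∃ ((var zero `= renameᵗ suc t) `∧ φ)

[0≔]-sem : ∀ {k} (φ : Formula (suc k)) t e → Sat (φ [0≔ t ]) e ⇔ Sat φ (⟦ t ⟧t e ∷ e)
[0≔]-sem φ t e = mk⇔
  (λ (x , x≡t , φx) → ≡-subst (λ z → Sat φ (z ∷ e)) (trans x≡t (weakenᵗ-sem x e t)) φx)
  (λ φt → ⟦ t ⟧t e , sym (weakenᵗ-sem _ e t) , φt)

infix 4 _<ᶠ_
_<ᶠ_ : ∀ {k} → Fin k → Fin k → Formula k
i <ᶠ j = `∃ ((var (suc i) `+ `S (var zero)) `= var (suc j))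

<ᶠ-sem : ∀ {k} (i j : Fin k) e → Sat (i <ᶠ j) e ⇔ lookup e i < lookup e j
<ᶠ-sem i j e = mk⇔ (λ (w , i+1+w≡j) → ≡-subst (lookup e i <_) i+1+w≡j (m<m+n _ z<s))
                   (λ i<j → proj₁ (m≤n⇒∃[o]m+o≡n i<j) , trans (+-suc _ _) (proj₂ (m≤n⇒∃[o]m+o≡n i<j)))

β-formula : ∀ {k} → Fin k → Fin k → Term k → Fin k → Formula k
β-formula {k} c d i r = `∃ (var (suc c) `= ((var zero `* m) `+ var (suc r)))
                     `∧ `∃ ((var (suc r) `+ `S (var zero)) `= m)
  where
  m : Term (suc k)
  m = `S (`S (renameᵗ suc i) `* var (suc d))

β-formula-sem : ∀ {k} (c d : Fin k) i r e →
  Sat (β-formula c d i r) e ⇔ Remainder (lookup e c) (β-modulus (lookup e d) (⟦ i ⟧t e)) (lookup e r)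
β-formula-sem c d i r e =
     Σ-cong-⇔ (λ {q} → ⇔-reflexive (cong (λ m → lookup e c ≡ q * m + lookup e r) (modulus q)))
  ×-⇔ Σ-cong-⇔ (λ {w} → ⇔-reflexive (cong (λ m → lookup e r + suc w ≡ m) (modulus w)))
  where
  modulus : ∀ x → β-modulus (lookup e d) (⟦ renameᵗ suc i ⟧t (x ∷ e)) ≡ β-modulus (lookup e d) (⟦ i ⟧t e)
  modulus x = cong (β-modulus (lookup e d)) (weakenᵗ-sem x e i)

⋀ : ∀ {m k} → (Fin m → Formula k) → Formula k
⋀ {zero}  φ = `0 `= `0
⋀ {suc m} φ = φ zero `∧ ⋀ (φ ∘ suc)

⋀-sem : ∀ {m k} (φ : Fin m → Formula k) e → Sat (⋀ φ) e ⇔ (∀ i → Sat (φ i) e)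
⋀-sem {zero}  φ e = mk⇔ (λ _ ()) (λ _ → refl)
⋀-sem {suc m} φ e = mk⇔ (λ { (φ₀ , φₛ) zero → φ₀ ; (φ₀ , φₛ) (suc i) → to (⋀-sem (φ ∘ suc) e) φₛ i })
                        (λ φᵢ → φᵢ zero , from (⋀-sem (φ ∘ suc) e) (φᵢ ∘ suc))

∃^ : ∀ m {k} → Formula (m + k) → Formula k
∃^ zero    φ = φ
∃^ (suc m) φ = ∃^ m (`∃ φ)

∃^-sem : ∀ m {k} (φ : Formula (m + k)) e → Sat (∃^ m φ) e ⇔ (∃[ ws ] Sat φ (ws ++ e))
∃^-sem zero    φ e = mk⇔ ([] ,_) (λ { ([] , φe) → φe })
∃^-sem (suc m) φ e = mk⇔ (λ ∃φ → uncons (to (∃^-sem m (`∃ φ) e) ∃φ))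
                         (λ { (w ∷ ws , φe) → from (∃^-sem m (`∃ φ) e) (ws , w , φe) })
  where
  uncons : (∃[ ws ] Sat (`∃ φ) (ws ++ e)) → ∃[ ws ] Sat φ (ws ++ e)
  uncons (ws , w , φe) = w ∷ ws , φe

⇓-deterministic : ∀ {n} {P : Prog n} {xs y y′} → P [ xs ]⇓ y → P [ xs ]⇓ y′ → y ≡ y′
⇓*-deterministic : ∀ {m n} {gs : Vec (Prog n) m} {xs ys ys′} → gs [ xs ]⇓* ys → gs [ xs ]⇓* ys′ → ys ≡ ys′
⇓-deterministic zero⇓ zero⇓ = refl
⇓-deterministic succ⇓ succ⇓ = refl
⇓-deterministic proj⇓ proj⇓ = refl
⇓-deterministic (comp⇓ G F) (comp⇓ G′ F′) with ⇓*-deterministic G G′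
... | refl = ⇓-deterministic F F′
⇓-deterministic (prec0⇓ F) (prec0⇓ F′) = ⇓-deterministic F F′
⇓-deterministic (precS⇓ R G) (precS⇓ R′ G′) with ⇓-deterministic R R′
... | refl = ⇓-deterministic G G′
⇓-deterministic {y = y} {y′} (mu⇓ F₀ below) (mu⇓ F₀′ below′) with <-cmp y y′
... | tri≈ _ y≡y′ _ = y≡y′
... | tri< y<y′ _ _ with () ← ⇓-deterministic F₀ (proj₂ (below′ y y<y′))
... | tri> _ _ y′<y with () ← ⇓-deterministic (proj₂ (below y′ y′<y)) F₀′
⇓*-deterministic []⇓ []⇓ = refl
⇓*-deterministic (∷⇓ G Gs) (∷⇓ G′ Gs′) = cong₂ _∷_ (⇓-deterministic G G′) (⇓*-deterministic Gs Gs′)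

⇓*⇔lookup : ∀ {m n} (gs : Vec (Prog n) m) xs ws → gs [ xs ]⇓* ws ⇔ (∀ i → lookup gs i [ xs ]⇓ lookup ws i)
⇓*⇔lookup []       xs []       = mk⇔ (λ _ ()) (λ _ → []⇓)
⇓*⇔lookup (g ∷ gs) xs (w ∷ ws) =
  mk⇔ (λ { (∷⇓ G Gs) zero → G ; (∷⇓ G Gs) (suc i) → to (⇓*⇔lookup gs xs ws) Gs i })
      (λ Gᵢ → ∷⇓ (Gᵢ zero) (from (⇓*⇔lookup gs xs ws) (Gᵢ ∘ suc)))

comp⇓⇔ : ∀ {m n} {f : Prog m} {gs : Vec (Prog n) m} {xs y} →
         comp f gs [ xs ]⇓ y ⇔ (∃[ ws ] gs [ xs ]⇓* ws × f [ ws ]⇓ y)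
comp⇓⇔ = mk⇔ (λ { (comp⇓ G F) → _ , G , F }) (λ (_ , G , F) → comp⇓ G F)

comp₁⇓⇔ : ∀ {n} {f : Prog 1} {g : Prog n} {xs w y} → g [ xs ]⇓ w →
          comp f (g ∷ []) [ xs ]⇓ y ⇔ f [ w ∷ [] ]⇓ y
comp₁⇓⇔ {f = f} {xs = xs} {y = y} G = mk⇔
  (λ { (comp⇓ (∷⇓ G′ []⇓) F) → ≡-subst (λ w → f [ w ∷ [] ]⇓ y) (⇓-deterministic G′ G) F })
  (λ F → comp⇓ (∷⇓ G []⇓) F)

mu⇓⇔ : ∀ {n} {f : Prog (suc n)} {xs y} →
       mu f [ xs ]⇓ y ⇔ (f [ y ∷ xs ]⇓ 0 × ((z : ℕ) → z < y → ∃[ k ] f [ z ∷ xs ]⇓ suc k))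
mu⇓⇔ = mk⇔ (λ { (mu⇓ F₀ below) → F₀ , below }) (λ (F₀ , below) → mu⇓ F₀ below)

PrecTrace : ∀ {n} → Prog n → Prog (2 + n) → Vec ℕ n → ℕ → ℕ → Set
PrecTrace f g xs k y =
  Σ (ℕ → ℕ) λ a → f [ xs ]⇓ a 0 × ((i : ℕ) → i < k → g [ i ∷ a i ∷ xs ]⇓ a (suc i)) × a k ≡ y

update : (ℕ → ℕ) → ℕ → ℕ → ℕ → ℕ
update a k v i with i ≟ k
... | yes _ = v
... | no  _ = a i

update-≡ : ∀ a k v → update a k v k ≡ v
update-≡ a k v with k ≟ k
... | yes _   = refl
... | no  k≢k = ⊥-elim (k≢k refl)

update-< : ∀ a {k} v {i} → i < k → update a k v i ≡ a i
update-< a {k} v {i} i<k with i ≟ k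
... | yes refl = ⊥-elim (<-irrefl refl i<k)
... | no  _    = refl

PrecTrace-step : ∀ {n} {f : Prog n} {g xs k r z} →
                 PrecTrace f g xs k r → g [ k ∷ r ∷ xs ]⇓ z → PrecTrace f g xs (suc k) z
PrecTrace-step {f = f} {g} {xs} {k} {r} {z} (a , F , Gs , aₖ≡r) G =
  a′ , ≡-subst (f [ xs ]⇓_) (sym (update-< a {suc k} z z<s)) F , Gs′ , update-≡ a (suc k) z
  where
  a′ : ℕ → ℕ
  a′ = update a (suc k) z
  unchanged-below : ∀ {i v} → i < suc k → a′ (suc i) ≡ v →
                    g [ i ∷ a i ∷ xs ]⇓ v → g [ i ∷ a′ i ∷ xs ]⇓ a′ (suc i)
  unchanged-below {i} i<1+k refl = ≡-subst (λ u → g [ i ∷ u ∷ xs ]⇓ a′ (suc i)) (sym (update-< a z i<1+k))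
  Gs′ : (i : ℕ) → i < suc k → g [ i ∷ a′ i ∷ xs ]⇓ a′ (suc i)
  Gs′ i i<1+k with m≤n⇒m<n∨m≡n (≤-pred i<1+k)
  ... | inj₁ i<k  = unchanged-below i<1+k (update-< a z (s≤s i<k)) (Gs i i<k)
  ... | inj₂ refl = unchanged-below i<1+k (update-≡ a (suc k) z)
                      (≡-subst (λ u → g [ k ∷ u ∷ xs ]⇓ z) (sym aₖ≡r) G)

prec⇓⇒PrecTrace : ∀ {n} {f : Prog n} {g xs k y} → prec f g [ k ∷ xs ]⇓ y → PrecTrace f g xs k y
prec⇓⇒PrecTrace {y = y} (prec0⇓ F) = (λ _ → y) , F , (λ _ ()) , refl
prec⇓⇒PrecTrace (precS⇓ R G)      = PrecTrace-step (prec⇓⇒PrecTrace R) G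

PrecTrace⇒prec⇓ : ∀ {n} {f : Prog n} {g xs k y} → PrecTrace f g xs k y → prec f g [ k ∷ xs ]⇓ y
PrecTrace⇒prec⇓ {f = f} {g} {xs} {k} (a , F , Gs , refl) = prefix k ≤-refl
  where
  prefix : ∀ j → j ≤ k → prec f g [ j ∷ xs ]⇓ a j
  prefix zero    _   = prec0⇓ F
  prefix (suc j) j<k = precS⇓ (prefix j (<⇒≤ j<k)) (Gs j j<k)

prec⇓⇔PrecTrace : ∀ {n} {f : Prog n} {g xs k y} → prec f g [ k ∷ xs ]⇓ y ⇔ PrecTrace f g xs k y
prec⇓⇔PrecTrace = mk⇔ prec⇓⇒PrecTrace PrecTrace⇒prec⇓

-- Representability of programs

Represents : ∀ {n} → Formula (suc n) → Prog n → Set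
Represents φ P = ∀ xs y → Sat φ (y ∷ xs) ⇔ P [ xs ]⇓ y

comp-inner : ∀ {m n} → Fin m → Fin (suc n) → Fin (m + suc n)
comp-inner {n = n} i zero    = i ↑ˡ suc n
comp-inner {m}     i (suc j) = m ↑ʳ suc j

comp-outer : ∀ {m n} → Fin (suc m) → Fin (m + suc n)
comp-outer {m}     zero    = m ↑ʳ zero
comp-outer {n = n} (suc j) = j ↑ˡ suc n

-- ∃ w⃗ (⋀ᵢ wᵢ = gᵢ(x⃗) ∧ y = f(w⃗)), in the environment w⃗ ++ y ∷ x⃗
compᶠ : ∀ {m n} → Formula (suc m) → Vec (Formula (suc n)) m → Formula (suc n)
compᶠ {m} F Gs = ∃^ m (⋀ (λ i → rename (comp-inner i) (lookup Gs i)) `∧ rename comp-outer F)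

comp-represents : ∀ {m n} {F : Formula (suc m)} {f} {Gs : Vec (Formula (suc n)) m} {gs} →
  Represents F f → (∀ i → Represents (lookup Gs i) (lookup gs i)) → Represents (compᶠ F Gs) (comp f gs)
comp-represents {m} {n} {F} {f} {Gs} {gs} F-rep Gs-rep xs y = begin
  Sat (compᶠ F Gs) (y ∷ xs)                                    ≈⟨ ∃^-sem m _ (y ∷ xs) ⟩
  (Σ (Vec ℕ m) λ ws → Sat (⋀ inner) (ws ++ y ∷ xs) × Sat (rename comp-outer F) (ws ++ y ∷ xs))
                                                               ≈⟨ Σ-cong-⇔ (λ {ws} → arguments ws ×-⇔ outer ws) ⟩
  (Σ (Vec ℕ m) λ ws → gs [ xs ]⇓* ws × f [ ws ]⇓ y)            ≈⟨ comp⇓⇔ ⟨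
  comp f gs [ xs ]⇓ y                                          ∎
  where
  open ⇔-Reasoning
  inner : Fin m → Formula (m + suc n)
  inner i = rename (comp-inner i) (lookup Gs i)
  arguments : ∀ ws → Sat (⋀ inner) (ws ++ y ∷ xs) ⇔ gs [ xs ]⇓* ws
  arguments ws = ⇔-trans (⋀-sem inner _) (⇔-trans (Π-cong-⇔ argument) (⇔-sym (⇓*⇔lookup gs xs ws)))
    where
    agree : ∀ i → Agree (comp-inner i) (lookup ws i ∷ xs) (ws ++ y ∷ xs)
    agree i zero    = lookup-++ˡ ws (y ∷ xs) i
    agree i (suc j) = lookup-++ʳ ws (y ∷ xs) (suc j)
    argument : ∀ i → Sat (inner i) (ws ++ y ∷ xs) ⇔ lookup gs i [ xs ]⇓ lookup ws i
    argument i = ⇔-trans (rename-sem (agree i) (lookup Gs i)) (Gs-rep i xs (lookup ws i))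
  outer : ∀ ws → Sat (rename comp-outer F) (ws ++ y ∷ xs) ⇔ f [ ws ]⇓ y
  outer ws = ⇔-trans (rename-sem agree F) (F-rep ws y)
    where
    agree : Agree comp-outer (y ∷ ws) (ws ++ y ∷ xs)
    agree zero    = lookup-++ʳ ws (y ∷ xs) zero
    agree (suc j) = lookup-++ˡ ws (y ∷ xs) j

-- The next three formulas live in the environment d ∷ c ∷ y ∷ k ∷ x⃗.
prec-base : ∀ {n} → Formula (suc n) → Formula (4 + n)
prec-base F = `∃ (β-formula (# 2) (# 1) `0 (# 0) `∧ rename base-position F)
  where
  base-position : Fin (suc _) → Fin (5 + _)
  base-position zero    = zero
  base-position (suc j) = 5 ↑ʳ j

prec-step : ∀ {n} → Formula (3 + n) → Formula (4 + n)
prec-step G = `∀ ((# 0 <ᶠ # 4) `⇒ `∃ (`∃ (β-formula (# 4) (# 3) (var (# 2)) (# 1)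
                                     `∧ (β-formula (# 4) (# 3) (`S (var (# 2))) (# 0)
                                     `∧ rename step-position G))))
  where
  step-position : Fin (3 + _) → Fin (7 + _)
  step-position zero                = zero
  step-position (suc zero)          = # 2
  step-position (suc (suc zero))    = # 1
  step-position (suc (suc (suc j))) = 7 ↑ʳ j

prec-result : ∀ {n} → Formula (4 + n)
prec-result = β-formula (# 1) (# 0) (var (# 3)) (# 2)

-- ∃ c d (β(c, d, 0) = f(x⃗) ∧ ∀ i < k β(c, d, i + 1) = g(i, β(c, d, i), x⃗) ∧ β(c, d, k) = y)
precᶠ : ∀ {n} → Formula (suc n) → Formula (3 + n) → Formula (2 + n)
precᶠ F G = `∃ (`∃ (prec-base F `∧ (prec-step G `∧ prec-result)))

BetaTrace : ∀ {n} → Prog n → Prog (2 + n) → Vec ℕ n → (k y c d : ℕ) → Set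
BetaTrace f g xs k y c d =
    (∃[ r ] Remainder c (β-modulus d 0) r × f [ xs ]⇓ r)
  × ((i : ℕ) → i < k → ∃₂ λ u v → Remainder c (β-modulus d i) u
                                 × Remainder c (β-modulus d (suc i)) v × g [ i ∷ u ∷ xs ]⇓ v)
  × Remainder c (β-modulus d k) y

precᶠ-sem : ∀ {n} {F : Formula (suc n)} {G f g} → Represents F f → Represents G g →
  ∀ xs k y → Sat (precᶠ F G) (y ∷ k ∷ xs) ⇔ (∃₂ λ c d → BetaTrace f g xs k y c d)
precᶠ-sem {F = F} {G} {f} {g} F-rep G-rep xs k y = Σ-cong-⇔ λ {c} → Σ-cong-⇔ λ {d} →
  base c d ×-⇔ (step c d ×-⇔ β-formula-sem (# 1) (# 0) (var (# 3)) (# 2) (d ∷ c ∷ y ∷ k ∷ xs))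
  where
  base : ∀ c d → Sat (prec-base F) (d ∷ c ∷ y ∷ k ∷ xs) ⇔ (∃[ r ] Remainder c (β-modulus d 0) r × f [ xs ]⇓ r)
  base c d = Σ-cong-⇔ λ {r} →
       β-formula-sem (# 2) (# 1) `0 (# 0) (r ∷ d ∷ c ∷ y ∷ k ∷ xs)
    ×-⇔ ⇔-trans (rename-sem {e = r ∷ xs} (λ { zero → refl ; (suc j) → refl }) F) (F-rep xs r)
  step : ∀ c d → Sat (prec-step G) (d ∷ c ∷ y ∷ k ∷ xs) ⇔
                 ((i : ℕ) → i < k → ∃₂ λ u v → Remainder c (β-modulus d i) u
                                             × Remainder c (β-modulus d (suc i)) v × g [ i ∷ u ∷ xs ]⇓ v)
  step c d = Π-cong-⇔ λ i → →-cong-⇔ (<ᶠ-sem (# 0) (# 4) (i ∷ d ∷ c ∷ y ∷ k ∷ xs))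
    (Σ-cong-⇔ λ {u} → Σ-cong-⇔ λ {v} →
          β-formula-sem (# 4) (# 3) (var (# 2)) (# 1) (v ∷ u ∷ i ∷ d ∷ c ∷ y ∷ k ∷ xs)
      ×-⇔ (β-formula-sem (# 4) (# 3) (`S (var (# 2))) (# 0) (v ∷ u ∷ i ∷ d ∷ c ∷ y ∷ k ∷ xs)
      ×-⇔ ⇔-trans (rename-sem {e = v ∷ i ∷ u ∷ xs}
                     (λ { zero → refl ; (suc zero) → refl ; (suc (suc zero)) → refl ; (suc (suc (suc j))) → refl }) G)
                   (G-rep (i ∷ u ∷ xs) v)))

BetaTrace⇒PrecTrace : ∀ {n} {f : Prog n} {g xs k y c d} → BetaTrace f g xs k y c d → PrecTrace f g xs k y
BetaTrace⇒PrecTrace {f = f} {g} {xs} {k} {c = c} {d} ((r , Rᵣ , F) , steps , Rʸ) =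
  a , ≡-subst (f [ xs ]⇓_) (sym (Remainder⇒%≡ Rᵣ)) F , Gs , Remainder⇒%≡ Rʸ
  where
  a : ℕ → ℕ
  a i = c % β-modulus d i
  Gs : (i : ℕ) → i < k → g [ i ∷ a i ∷ xs ]⇓ a (suc i)
  Gs i i<k with u , v , Rᵘ , Rᵛ , G ← steps i i<k =
    subst₂ (λ u v → g [ i ∷ u ∷ xs ]⇓ v) (sym (Remainder⇒%≡ Rᵘ)) (sym (Remainder⇒%≡ Rᵛ)) G

PrecTrace⇒BetaTrace : ∀ {n} {f : Prog n} {g xs k y} → PrecTrace f g xs k y → ∃₂ λ c d → BetaTrace f g xs k y c d
PrecTrace⇒BetaTrace {f = f} {g} {xs} {k} (a , F , Gs , refl) = encode (β-lemma a k)
  where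
  encode : (∃₂ λ c d → ∀ {i} → i ≤ k → Remainder c (β-modulus d i) (a i)) → ∃₂ λ c d → BetaTrace f g xs k (a k) c d
  encode (c , d , R) =
    c , d , (a 0 , R z≤n , F) , (λ i i<k → a i , a (suc i) , R (<⇒≤ i<k) , R i<k , Gs i i<k) , R ≤-refl

prec-represents : ∀ {n} {F : Formula (suc n)} {G f g} →
  Represents F f → Represents G g → Represents (precᶠ F G) (prec f g)
prec-represents F-rep G-rep (k ∷ xs) y = begin
  Sat (precᶠ _ _) (y ∷ k ∷ xs)             ≈⟨ precᶠ-sem F-rep G-rep xs k y ⟩
  (∃₂ λ c d → BetaTrace _ _ xs k y c d)    ≈⟨ mk⇔ (BetaTrace⇒PrecTrace ∘ proj₂ ∘ proj₂) PrecTrace⇒BetaTrace ⟩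
  PrecTrace _ _ xs k y                     ≈⟨ prec⇓⇔PrecTrace ⟨
  prec _ _ [ k ∷ xs ]⇓ y                   ∎
  where open ⇔-Reasoning

-- ∀ z < y ∃ k (f(z, x⃗) = S k)
mu-below : ∀ {n} → Formula (2 + n) → Formula (suc n)
mu-below F = `∀ ((# 0 <ᶠ # 1) `⇒ `∃ (rename position F [0≔ `S (var (# 0)) ]))
  where
  position : Fin (2 + _) → Fin (4 + _)
  position zero          = zero
  position (suc zero)    = # 2
  position (suc (suc j)) = 4 ↑ʳ j

muᶠ : ∀ {n} → Formula (2 + n) → Formula (suc n)
muᶠ F = (F [0≔ `0 ]) `∧ mu-below F

mu-represents : ∀ {n} {F : Formula (2 + n)} {f} → Represents F f → Represents (muᶠ F) (mu f)
mu-represents {F = F} {f} F-rep xs y = ⇔-trans (zero-at-y ×-⇔ positive-below) (⇔-sym mu⇓⇔)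
  where
  zero-at-y : Sat (F [0≔ `0 ]) (y ∷ xs) ⇔ f [ y ∷ xs ]⇓ 0
  zero-at-y = ⇔-trans ([0≔]-sem F `0 (y ∷ xs)) (F-rep (y ∷ xs) 0)
  positive-below : Sat (mu-below F) (y ∷ xs) ⇔
                   ((z : ℕ) → z < y → ∃[ k ] f [ z ∷ xs ]⇓ suc k)
  positive-below = Π-cong-⇔ λ z → →-cong-⇔ (<ᶠ-sem (# 0) (# 1) (z ∷ y ∷ xs)) (Σ-cong-⇔ λ {k} →
    ⇔-trans ([0≔]-sem _ (`S (var (# 0))) (k ∷ z ∷ y ∷ xs))
            (⇔-trans (rename-sem {e = suc k ∷ z ∷ xs} (λ { zero → refl ; (suc zero) → refl ; (suc (suc j)) → refl }) F)
                     (F-rep (z ∷ xs) (suc k))))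

graph : ∀ {n} → Prog n → Formula (suc n)
graphs : ∀ {m n} → Vec (Prog n) m → Vec (Formula (suc n)) m
graph zeroF       = var zero `= `0
graph succF       = var zero `= `S (var (suc zero))
graph (proj i)    = var zero `= var (suc i)
graph (comp f gs) = compᶠ (graph f) (graphs gs)
graph (prec f g)  = precᶠ (graph f) (graph g)
graph (mu f)      = muᶠ (graph f)
graphs []       = []
graphs (g ∷ gs) = graph g ∷ graphs gs

represents : ∀ {n} (P : Prog n) → Represents (graph P) P
represents-lookup : ∀ {m n} (gs : Vec (Prog n) m) i → Represents (lookup (graphs gs) i) (lookup gs i)
represents zeroF       xs       y = mk⇔ (λ { refl → zero⇓ }) (λ { zero⇓ → refl })
represents succF       (x ∷ []) y = mk⇔ (λ { refl → succ⇓ }) (λ { succ⇓ → refl })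
represents (proj i)    xs       y = mk⇔ (λ { refl → proj⇓ }) (λ { proj⇓ → refl })
represents (comp f gs)          = comp-represents {Gs = graphs gs} (represents f) (represents-lookup gs)
represents (prec f g)           = prec-represents (represents f) (represents g)
represents (mu f)               = mu-represents (represents f)
represents-lookup (g ∷ gs) zero    = represents g
represents-lookup (g ∷ gs) (suc i) = represents-lookup gs i

-- Computing Gödel numbers

constᵖ : ∀ {n} → ℕ → Prog n
constᵖ zero    = zeroF
constᵖ (suc c) = comp succF (constᵖ c ∷ [])

const⇓ : ∀ {n} c {xs : Vec ℕ n} → constᵖ c [ xs ]⇓ c
const⇓ zero    = zero⇓
const⇓ (suc c) = comp⇓ (∷⇓ (const⇓ c) []⇓) succ⇓

addᵖ : Prog 2
addᵖ = prec (proj zero) (comp succF (proj (suc zero) ∷ []))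

add⇓ : ∀ a b → addᵖ [ a ∷ b ∷ [] ]⇓ (a + b)
add⇓ zero    b = prec0⇓ proj⇓
add⇓ (suc a) b = precS⇓ (add⇓ a b) (comp⇓ (∷⇓ proj⇓ []⇓) succ⇓)

triᵖ : Prog 1
triᵖ = prec zeroF (comp addᵖ (comp succF (proj zero ∷ []) ∷ proj (suc zero) ∷ []))

tri⇓ : ∀ k → triᵖ [ k ∷ [] ]⇓ tri k
tri⇓ zero    = prec0⇓ zero⇓
tri⇓ (suc k) = precS⇓ (tri⇓ k) (comp⇓ (∷⇓ (comp⇓ (∷⇓ proj⇓ []⇓) succ⇓) (∷⇓ proj⇓ []⇓)) (add⇓ (suc k) (tri k)))

pairᵖ : Prog 2
pairᵖ = comp addᵖ (comp triᵖ (addᵖ ∷ []) ∷ proj (suc zero) ∷ [])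

pair⇓ : ∀ a b → pairᵖ [ a ∷ b ∷ [] ]⇓ pair a b
pair⇓ a b = comp⇓ (∷⇓ (comp⇓ (∷⇓ (add⇓ a b) []⇓) (tri⇓ (a + b))) (∷⇓ proj⇓ []⇓)) (add⇓ (tri (a + b)) b)

infixr 5 _,ᵖ_
_,ᵖ_ : ∀ {n} → Prog n → Prog n → Prog n
P ,ᵖ Q = comp pairᵖ (P ∷ Q ∷ [])

,ᵖ⇓ : ∀ {n} {P Q : Prog n} {xs a b} → P [ xs ]⇓ a → Q [ xs ]⇓ b → (P ,ᵖ Q) [ xs ]⇓ pair a b
,ᵖ⇓ {a = a} {b} P⇓ Q⇓ = comp⇓ (∷⇓ P⇓ (∷⇓ Q⇓ []⇓)) (pair⇓ a b)

num : ∀ {k} → ℕ → Term k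
num zero    = `0
num (suc m) = `S (num m)

⟦num⟧ : ∀ {k} m (e : Vec ℕ k) → ⟦ num m ⟧t e ≡ m
⟦num⟧ zero    e = refl
⟦num⟧ (suc m) e = cong suc (⟦num⟧ m e)

numᵖ : Prog 1
numᵖ = prec (constᵖ (gnt {0} `0)) (constᵖ 2 ,ᵖ proj (suc zero))

num⇓ : ∀ {k} m → numᵖ [ m ∷ [] ]⇓ gnt (num {k} m)
num⇓ zero    = prec0⇓ (const⇓ _)
num⇓ (suc m) = precS⇓ (num⇓ m) (,ᵖ⇓ (const⇓ 2) proj⇓)

-- diag is opaque, and the diagonal lemma is stated for an arbitrary program computing it,
-- so that type checking never normalises the Gödel number of a concrete formula: such
-- numerals are astronomically large.
opaque
  diag : Formula 1 → Sentence
  diag φ = `∃ ((var zero `= num (gn φ)) `∧ φ)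

-- 7, 2 and 0 are the codes of ∃, ∧ and = in gn.
diagᵖ : Prog 1
diagᵖ = constᵖ 7 ,ᵖ constᵖ 2 ,ᵖ (constᵖ 0 ,ᵖ constᵖ (gnt {1} (var zero)) ,ᵖ numᵖ) ,ᵖ proj zero

opaque
  unfolding diag

  diag⇓ : ∀ φ → diagᵖ [ gn φ ∷ [] ]⇓ gn (diag φ)
  diag⇓ φ = ,ᵖ⇓ (const⇓ 7) (,ᵖ⇓ (const⇓ 2)
              (,ᵖ⇓ (,ᵖ⇓ (const⇓ 0) (,ᵖ⇓ (const⇓ (gnt {1} (var zero))) (num⇓ {1} (gn φ)))) proj⇓))

  diag-sem : ∀ φ → Sat (diag φ) [] ⇔ Sat φ (gn φ ∷ [])
  diag-sem φ = mk⇔ (λ (x , x≡⌜φ⌝ , φx) → ≡-subst (λ z → Sat φ (z ∷ [])) (trans x≡⌜φ⌝ (⟦num⟧ (gn φ) _)) φx)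
                   (λ φ⌜φ⌝ → gn φ , sym (⟦num⟧ (gn φ) _) , φ⌜φ⌝)

-- Undefinability of truth

-- Only ¬¬-truth is asked for on output 1: that is all the diagonal argument needs,
-- and all that the reduction from a propositional formula provides constructively.
DecidesTruth : Prog 1 → Set
DecidesTruth T = ∀ σ → ∃[ y ] T [ gn σ ∷ [] ]⇓ y × ((¬ ¬ Sat σ [] × y ≡ 1) ⊎ (¬ Sat σ [] × y ≡ 0))


diagonal-lemma : ∀ {D} → (∀ φ → D [ gn φ ∷ [] ]⇓ gn (diag φ)) →
                 ∀ T → ∃[ σ ] Sat σ [] ⇔ (¬ T [ gn σ ∷ [] ]⇓ 1)
diagonal-lemma {D} D⇓ T = diag φ , ⇔-trans unfold-diag (⇔-trans unfold-[0≔] (⇔-trans unfold-graph unfold-R))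
  where
  R : Prog 1
  R = comp T (D ∷ [])
  -- φ(x) says "R does not output 1 on x", so diag φ = φ(⌜φ⌝) says "T does not output 1 on ⌜diag φ⌝".
  φ : Formula 1
  φ = `¬ (graph R [0≔ `S `0 ])
  unfold-diag : Sat (diag φ) [] ⇔ (¬ Sat (graph R [0≔ `S `0 ]) (gn φ ∷ []))
  unfold-diag = diag-sem φ
  unfold-[0≔] : (¬ Sat (graph R [0≔ `S `0 ]) (gn φ ∷ [])) ⇔ (¬ Sat (graph R) (1 ∷ gn φ ∷ []))
  unfold-[0≔] = ¬-cong-⇔ ([0≔]-sem (graph R) (`S `0) (gn φ ∷ []))
  unfold-graph : (¬ Sat (graph R) (1 ∷ gn φ ∷ [])) ⇔ (¬ R [ gn φ ∷ [] ]⇓ 1)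
  unfold-graph = ¬-cong-⇔ (represents R (gn φ ∷ []) 1)
  unfold-R : (¬ R [ gn φ ∷ [] ]⇓ 1) ⇔ (¬ T [ gn (diag φ) ∷ [] ]⇓ 1)
  unfold-R = ¬-cong-⇔ (comp₁⇓⇔ (D⇓ φ))

defeats : ∀ {T σ} → Sat σ [] ⇔ (¬ T [ gn σ ∷ [] ]⇓ 1) →
          ¬ (∃[ y ] T [ gn σ ∷ [] ]⇓ y × ((¬ ¬ Sat σ [] × y ≡ 1) ⊎ (¬ Sat σ [] × y ≡ 0)))
defeats σ⇔T↛1 (_ , T⇓1 , inj₁ (¬¬σ , refl)) = ¬¬σ λ σ-true → to σ⇔T↛1 σ-true T⇓1
defeats σ⇔T↛1 (_ , T⇓0 , inj₂ (¬σ  , refl)) = ¬σ (from σ⇔T↛1 λ T⇓1 → 0≢1+n (⇓-deterministic T⇓0 T⇓1))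

truth-undecidable : ∀ T → ¬ DecidesTruth T
truth-undecidable T decides = defeats (proj₂ fixed-point) (decides (proj₁ fixed-point))
  where
  fixed-point : ∃[ σ ] Sat σ [] ⇔ (¬ T [ gn σ ∷ [] ]⇓ 1)
  fixed-point = diagonal-lemma diag⇓ T

-- Reduction to the propositional formula

Truth : Bool → Set → Set
Truth true  X = X
Truth false X = ¬ X

truth-¬ : ∀ a {X} → Truth a X → Truth (not a) (¬ X)
truth-¬ true  x  = λ ¬x → ¬x x
truth-¬ false ¬x = ¬x

truth-∧ : ∀ a b {X Y} → Truth a X → Truth b Y → Truth (a ∧ b) (X × Y)
truth-∧ true  true  x  y  = x , y
truth-∧ true  false x  ¬y = ¬y ∘ proj₂
truth-∧ false b     ¬x _  = ¬x ∘ proj₁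

truth-∨ : ∀ a b {X Y} → Truth a X → Truth b Y → Truth (a ∨ b) (X ⊎ Y)
truth-∨ true  b     x  _  = inj₁ x
truth-∨ false true  _  y  = inj₂ y
truth-∨ false false ¬x ¬y = [ ¬x , ¬y ]

truth-⇒ : ∀ a b {X Y} → Truth a X → Truth b Y → Truth (a ⇒ᵇ b) (X → Y)
truth-⇒ true  true  _  y  = λ _ → y
truth-⇒ true  false x  ¬y = λ x→y → ¬y (x→y x)
truth-⇒ false b     ¬x _  = λ x → ⊥-elim (¬x x)

truth-subst : ∀ {n} (v : Fin n → Bool) (φs : Vec Sentence n) → (∀ i → Truth (v i) (Sat (lookup φs i) [])) →
              ∀ B → Truth (peval v B) (Sat (subst B φs) [])
truth-subst v φs atoms = go
  where
  go : ∀ B → Truth (peval v B) (Sat (subst B φs) [])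
  go (pvar i)  = atoms i
  go (p¬ B)    = truth-¬ (peval v B) (go B)
  go (B p∧ C)  = truth-∧ (peval v B) (peval v C) (go B) (go C)
  go (B p∨ C)  = truth-∨ (peval v B) (peval v C) (go B) (go C)
  go (B p⇒ C)  = truth-⇒ (peval v B) (peval v C) (go B) (go C)
  go (B p⇔ C)  = truth-∧ (peval v B ⇒ᵇ peval v C) (peval v C ⇒ᵇ peval v B)
                   (truth-⇒ (peval v B) (peval v C) (go B) (go C)) (truth-⇒ (peval v C) (peval v B) (go C) (go B))

literal : Bool → Bool → Sentence → Sentence
literal true  true  ψ = `0 `= `0
literal false false ψ = `¬ (`0 `= `0)
literal true  false ψ = ψ
literal false true  ψ = `¬ ψ

literal-true : ∀ b⁺ b⁻ {ψ} → Sat ψ [] → Truth b⁺ (Sat (literal b⁺ b⁻ ψ) [])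
literal-true true  true  ψ = refl
literal-true false false ψ = λ ¬0≡0 → ¬0≡0 refl
literal-true true  false ψ = ψ
literal-true false true  ψ = λ ¬ψ → ¬ψ ψ

literal-false : ∀ b⁺ b⁻ {ψ} → ¬ Sat ψ [] → Truth b⁻ (Sat (literal b⁺ b⁻ ψ) [])
literal-false true  true  ¬ψ = refl
literal-false false false ¬ψ = λ ¬0≡0 → ¬0≡0 refl
literal-false true  false ¬ψ = ¬ψ
literal-false false true  ¬ψ = ¬ψ

literalᵖ : Bool → Bool → Prog 1
literalᵖ true  true  = constᵖ (gn {0} (`0 `= `0))
literalᵖ false false = constᵖ (gn {0} (`¬ (`0 `= `0)))
literalᵖ true  false = proj zero
literalᵖ false true  = constᵖ 1 ,ᵖ proj zero

literal⇓ : ∀ b⁺ b⁻ ψ → literalᵖ b⁺ b⁻ [ gn ψ ∷ [] ]⇓ gn (literal b⁺ b⁻ ψ)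
literal⇓ true  true  ψ = const⇓ (gn {0} (`0 `= `0))
literal⇓ false false ψ = const⇓ (gn {0} (`¬ (`0 `= `0)))
literal⇓ true  false ψ = proj⇓
literal⇓ false true  ψ = ,ᵖ⇓ (const⇓ 1) proj⇓

nonconstant⇒DecidesTruth : ∀ {n} {A : PForm n} {P} → DecidesTruthOf P A →
  ∀ v⁺ v⁻ → peval v⁺ A ≡ true → peval v⁻ A ≡ false →
  DecidesTruth (comp P (tabulate λ i → literalᵖ (v⁺ i) (v⁻ i)))
nonconstant⇒DecidesTruth {n} {A} {P} decides v⁺ v⁻ A[v⁺] A[v⁻] σ = verdict (decides (literals σ))
  where
  literals : Sentence → Vec Sentence n
  literals ψ = tabulate λ i → literal (v⁺ i) (v⁻ i) ψ
  literalsᵖ : Vec (Prog 1) n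
  literalsᵖ = tabulate λ i → literalᵖ (v⁺ i) (v⁻ i)
  literals⇓ : ∀ ψ → literalsᵖ [ gn ψ ∷ [] ]⇓* map gn (literals ψ)
  literals⇓ ψ = from (⇓*⇔lookup literalsᵖ (gn ψ ∷ []) (map gn (literals ψ))) λ i →
    subst₂ (λ Q z → Q [ gn ψ ∷ [] ]⇓ z)
      (sym (lookup∘tabulate (λ i → literalᵖ (v⁺ i) (v⁻ i)) i))
      (sym (trans (lookup-map i gn (literals ψ)) (cong gn (lookup∘tabulate (λ i → literal (v⁺ i) (v⁻ i) ψ) i))))
      (literal⇓ (v⁺ i) (v⁻ i) ψ)
  truth-instance : ∀ v {b} → peval v A ≡ b → (∀ i → Truth (v i) (Sat (literal (v⁺ i) (v⁻ i) σ) [])) →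
                   Truth b (Sat (subst A (literals σ)) [])
  truth-instance v refl atoms = truth-subst v (literals σ)
    (λ i → ≡-subst (λ φ → Truth (v i) (Sat φ [])) (sym (lookup∘tabulate _ i)) (atoms i)) A
  A-true : Sat σ [] → Sat (subst A (literals σ)) []
  A-true σ-true = truth-instance v⁺ A[v⁺] λ i → literal-true (v⁺ i) (v⁻ i) σ-true
  A-false : ¬ Sat σ [] → ¬ Sat (subst A (literals σ)) []
  A-false ¬σ = truth-instance v⁻ A[v⁻] λ i → literal-false (v⁺ i) (v⁻ i) ¬σ
  verdict : (∃[ y ] P [ map gn (literals σ) ]⇓ y ×
                ((ℕ ⊨ subst A (literals σ) × y ≡ 1) ⊎ (¬ (ℕ ⊨ subst A (literals σ)) × y ≡ 0))) →
            ∃[ y ] comp P literalsᵖ [ gn σ ∷ [] ]⇓ y × ((¬ ¬ Sat σ [] × y ≡ 1) ⊎ (¬ Sat σ [] × y ≡ 0))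
  verdict (y , P⇓y , inj₁ (A-holds , y≡1)) = y , comp⇓ (literals⇓ σ) P⇓y , inj₁ ((λ ¬σ → A-false ¬σ A-holds) , y≡1)
  verdict (y , P⇓y , inj₂ (¬A-holds , y≡0)) = y , comp⇓ (literals⇓ σ) P⇓y , inj₂ (¬A-holds ∘ A-true , y≡0)

peval-cong : ∀ {n} {v v′ : Fin n → Bool} → (∀ i → v i ≡ v′ i) → ∀ B → peval v B ≡ peval v′ B
peval-cong v≗v′ (pvar i) = v≗v′ i
peval-cong v≗v′ (p¬ B)   = cong not (peval-cong v≗v′ B)
peval-cong v≗v′ (B p∧ C) = cong₂ _∧_ (peval-cong v≗v′ B) (peval-cong v≗v′ C)
peval-cong v≗v′ (B p∨ C) = cong₂ _∨_ (peval-cong v≗v′ B) (peval-cong v≗v′ C)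
peval-cong v≗v′ (B p⇒ C) = cong₂ _⇒ᵇ_ (peval-cong v≗v′ B) (peval-cong v≗v′ C)
peval-cong v≗v′ (B p⇔ C) = cong₂ _⇔ᵇ_ (peval-cong v≗v′ B) (peval-cong v≗v′ C)

∷ᶠ-cong : ∀ {n} {h : Bool} {v v′ : Fin n → Bool} → (∀ i → v i ≡ v′ i) → ∀ i → (h ∷ᶠ v) i ≡ (h ∷ᶠ v′) i
∷ᶠ-cong v≗v′ zero    = refl
∷ᶠ-cong v≗v′ (suc i) = v≗v′ i

-- F must respect pointwise equality: assignments are functions and there is no funext.
constant-or-witness : ∀ n (F : (Fin n → Bool) → Bool) → (∀ {v v′} → (∀ i → v i ≡ v′ i) → F v ≡ F v′) →
                      ∀ b → (∀ v → F v ≡ b) ⊎ ∃[ v ] F v ≡ not b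
constant-or-witness zero F F-cong b with F (λ ()) Bool.≟ b
... | yes F≡b = inj₁ λ v → trans (F-cong λ ()) F≡b
... | no  F≢b = inj₂ ((λ ()) , ¬-not F≢b)
constant-or-witness (suc n) F F-cong b
  with constant-or-witness n (F ∘ (true ∷ᶠ_)) (F-cong ∘ ∷ᶠ-cong) b
     | constant-or-witness n (F ∘ (false ∷ᶠ_)) (F-cong ∘ ∷ᶠ-cong) b
... | inj₂ (v , Fv) | _             = inj₂ (true ∷ᶠ v , Fv)
... | inj₁ _        | inj₂ (v , Fv) = inj₂ (false ∷ᶠ v , Fv)
... | inj₁ F[true]  | inj₁ F[false] = inj₁ λ v → trans (F-cong (head∷tail v)) (by-head (v zero) (v ∘ suc))
  where
  head∷tail : ∀ v i → v i ≡ (v zero ∷ᶠ (v ∘ suc)) i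
  head∷tail v zero    = refl
  head∷tail v (suc i) = refl
  by-head : ∀ h w → F (h ∷ᶠ w) ≡ b
  by-head true  = F[true]
  by-head false = F[false]

peval-constant-or-witness : ∀ {n} (A : PForm n) b → (∀ v → peval v A ≡ b) ⊎ ∃[ v ] peval v A ≡ not b
peval-constant-or-witness {n} A = constant-or-witness n (λ v → peval v A) (λ v≗v′ → peval-cong v≗v′ A)

theorem2 : (n : ℕ) (A : PForm n) (P : Prog n) →
    DecidesTruthOf P A → Tautology A ⊎ Contradictory A
theorem2 n A P decides with peval-constant-or-witness A true
... | inj₁ tautology = inj₁ tautology
... | inj₂ (v⁻ , A[v⁻]) with peval-constant-or-witness A false
...   | inj₁ contradictory = inj₂ contradictory
...   | inj₂ (v⁺ , A[v⁺]) = ⊥-elim (truth-undecidable _ (nonconstant⇒DecidesTruth {A = A} decides v⁺ v⁻ A[v⁺] A[v⁻]))
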